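{- Let $0\le q<1$, let $w=(w_{i,j})_{1\le i\le N,1\le j\le m}$ be a matrix of nonnegative integers, and let $(\lambda^k_j(n))$ be the GT patterns produced by $q$RSK applied to $w$ from the empty initial condition. Then almost surely, for all $0\le n\le N$ and $1\le k\le m$, $$\lambda^k_1(n)+\lambda^k_2(n)+\dots+\lambda^k_{\min(k,n)}(n)=\sum_{i=1}^n\sum_{j=1}^k w_{i,j}.$$
   Context: Notation: $(k)_q=(q;q)_k$, $\binom{a}{b}_q=\frac{(a)_q}{(b)_q(a-b)_q}$, $0^0=1$. $q\mathrm{Hyp}(m_1,m_2,k)$ ($m_1,k\in\mathbb N$, $m_2\in\mathbb N\cup\{\infty\}$) has pmf $s\mapsto q^{(m_1-s)(k-s)}\binom{m_1}{s}_q\binom{m_2}{k-s}_q/\binom{m_1+m_2}{k}_q$ on $\max(0,k-m_2)\le s\le\min(m_1,k)$ (for $m_2=\infty$: $q^{(m_1-s)(k-s)}\frac{(m_1)_q(k)_q}{(s)_q(m_1-s)_q(k-s)_q}$). $q$RSK: GT patterns $(\lambda^j_k)_{1\le k\le j\le m}$ with $\lambda^{j+1}_{k+1}\le\lambda^j_k\le\lambda^{j+1}_k$; conventions $\lambda^j_0=\infty$, $\lambda^j_k=0$ for $k>j$, level-$0$ entries $0$. Inserting $(a_1,\dots,a_m)$ into $\lambda$ to get $\tilde\lambda$: $a^j_1=a_j$; for $j=1,\dots,m$, for $k=1,\dots,j$: if $k<j$, sample independently $a^j_{k+1}\sim q\mathrm{Hyp}(\tilde\lambda^{j-1}_k-\lambda^{j-1}_k,\lambda^{j-1}_{k-1}-\tilde\lambda^{j-1}_k,\lambda^j_k-\lambda^{j-1}_k)$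 and set $\tilde\lambda^j_k=a^j_k+\lambda^j_k+\tilde\lambda^{j-1}_k-\lambda^{j-1}_k-a^j_{k+1}$; if $k=j$ set $\tilde\lambda^j_j=\lambda^j_j+a^j_j$. With $\lambda(0)\equiv0$, $\lambda(n)$ is the insertion of $(w_{n,1},\dots,w_{n,m})$ into $\lambda(n-1)$ with fresh randomness.
   Formalization: The parameter q is a rational number with $0\le q<1$. -}

module Defs where

open import Data.Nat as ℕ using (ℕ; zero; suc; _≤?_; _<?_)
open import Data.Integer as ℤ using (ℤ; +_)
open import Data.Rational as ℚ using (ℚ; 0ℚ; 1ℚ)
open import Data.Fin using (Fin; fromℕ<)
open import Data.Maybe using (Maybe; just; nothing)
open import Data.Product using (Σ; ∃; _×_; _,_)
open import Relation.Nullary using (yes; no)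
open import Relation.Binary.PropositionalEquality using (_≡_)

pow : ℚ → ℕ → ℚ
pow q zero    = 1ℚ
pow q (suc e) = q ℚ.* pow q e

qProdFrom : ℚ → ℕ → ℕ → ℚ
qProdFrom q lo zero      = 1ℚ
qProdFrom q lo (suc len) = (1ℚ ℚ.- pow q (suc lo)) ℚ.* qProdFrom q (suc lo) len

qPoch : ℚ → ℕ → ℚ
qPoch q k = qProdFrom q 0 k

-- q-binomial coefficient binom(n,k)_q = (n)_q / ((k)_q (n-k)_q) for k ≤ n,
-- and 0 for k > n; computed via the q-Pascal rule (no division needed)
qBinom : ℚ → ℕ → ℕ → ℚ
qBinom q n       zero    = 1ℚ
qBinom q zero    (suc k) = 0ℚ
qBinom q (suc n) (suc k) = qBinom q n k ℚ.+ pow q (suc k) ℚ.* qBinom q n (suc k)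

-- Extended naturals for the parameter m₂ ∈ ℕ ∪ {∞}: nothing = ∞
ℕ∞ : Set
ℕ∞ = Maybe ℕ

InRange : ℕ → ℕ∞ → ℕ → ℕ → Set
InRange m₁ nothing   k s = s ℕ.≤ m₁ × s ℕ.≤ k
InRange m₁ (just m₂) k s = s ℕ.≤ m₁ × s ℕ.≤ k × k ℕ.≤ s ℕ.+ m₂

-- Weight of s under qHyp(m₁,m₂,k):
--  * m₂ finite : q^{(m₁-s)(k-s)} binom(m₁,s)_q binom(m₂,k-s)_q
--                ( = pmf(s) · binom(m₁+m₂,k)_q, a positive constant factor )
--  * m₂ = ∞    : q^{(m₁-s)(k-s)} (m₁)_q (k)_q / ((s)_q (m₁-s)_q (k-s)_q)
--                = q^{(m₁-s)(k-s)} binom(m₁,s)_q ∏_{i=k-s+1}^{k} (1-q^i)  ( = pmf(s) exactly )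
qHypWeight : ℚ → ℕ → ℕ∞ → ℕ → ℕ → ℚ
qHypWeight q m₁ (just m₂) k s =
  pow q ((m₁ ℕ.∸ s) ℕ.* (k ℕ.∸ s)) ℚ.* qBinom q m₁ s ℚ.* qBinom q m₂ (k ℕ.∸ s)
qHypWeight q m₁ nothing k s =
  pow q ((m₁ ℕ.∸ s) ℕ.* (k ℕ.∸ s)) ℚ.* qBinom q m₁ s ℚ.* qProdFrom q (k ℕ.∸ s) s

qHypPos : ℚ → ℕ → ℕ∞ → ℕ → ℕ → Set
qHypPos q m₁ m₂ k s = InRange m₁ m₂ k s × 0ℚ ℚ.< qHypWeight q m₁ m₂ k s

-- Same, for integer-valued parameters/outcome (as they arise from the dynamics):
-- all of them must be natural numbers (m₂ may be ∞).
data ℤ∞ : Set where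
  fin : ℤ → ℤ∞
  ∞   : ℤ∞

SuppPos : ℚ → ℤ → ℤ∞ → ℤ → ℤ → Set
SuppPos q m₁ (fin m₂) k s = Σ ℕ λ M₁ → Σ ℕ λ M₂ → Σ ℕ λ K → Σ ℕ λ S →
  m₁ ≡ + M₁ × m₂ ≡ + M₂ × k ≡ + K × s ≡ + S × qHypPos q M₁ (just M₂) K S
SuppPos q m₁ ∞ k s = Σ ℕ λ M₁ → Σ ℕ λ K → Σ ℕ λ S →
  m₁ ≡ + M₁ × k ≡ + K × s ≡ + S × qHypPos q M₁ nothing K S

-- A GT pattern: pat j k = λ^j_k  (only 1 ≤ k ≤ j ≤ m is meaningful)
Pat : Set
Pat = ℕ → ℕ → ℤ

-- Random choices at one insertion step: smp j k = a^j_{k+1} (1 ≤ k < j)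
Choices : Set
Choices = ℕ → ℕ → ℤ

aVal : (ℕ → ℤ) → Choices → ℕ → ℕ → ℤ
aVal a smp j zero          = + 0
aVal a smp j (suc zero)    = a j
aVal a smp j (suc (suc k)) = smp j (suc k)

insert : Pat → (ℕ → ℤ) → Choices → ℕ → ℕ → ℤ
insert lam a smp zero    k = + 0
insert lam a smp (suc j) zero = + 0
insert lam a smp (suc j) (suc k) with suc k <? suc j | suc k ℕ.≟ suc j
... | yes _ | _     = aVal a smp (suc j) (suc k) ℤ.+ lam (suc j) (suc k)
                       ℤ.+ insert lam a smp j (suc k) ℤ.- lam j (suc k)
                       ℤ.- aVal a smp (suc j) (suc (suc k))
... | no _  | yes _ = lam (suc j) (suc j) ℤ.+ aVal a smp (suc j) (suc j)
... | no _  | no _  = + 0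

-- extend an N×m matrix to ℕ → ℕ → ℕ (1-based; 0 outside the range)
wExt : {N m : ℕ} → (Fin N → Fin m → ℕ) → ℕ → ℕ → ℕ
wExt {N} {m} w zero    j       = 0
wExt {N} {m} w (suc i) zero    = 0
wExt {N} {m} w (suc i) (suc j) with i <? N | j <? m
... | yes i<N | yes j<m = w (fromℕ< i<N) (fromℕ< j<m)
... | _       | _       = 0

-- Random choices for the whole run: smp n j k = a^j_{k+1} used when producing λ(n)
RunChoices : Set
RunChoices = ℕ → Choices

run : (ℕ → ℕ → ℕ) → RunChoices → ℕ → Pat
run w σ zero    = λ j k → + 0
run w σ (suc n) = insert (run w σ n) (λ j → + w (suc n) j) (σ (suc n))

-- parameters of the qHyp law of a^j_{k+1} at step n (λ = λ(n-1), λ̃ = λ(n))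
m₁Par : (ℕ → ℕ → ℕ) → RunChoices → ℕ → ℕ → ℕ → ℤ
m₁Par w σ n j k = run w σ n (j ℕ.∸ 1) k ℤ.- run w σ (n ℕ.∸ 1) (j ℕ.∸ 1) k

m₂Par : (ℕ → ℕ → ℕ) → RunChoices → ℕ → ℕ → ℕ → ℤ∞
m₂Par w σ n j (suc (suc k)) =
  fin (run w σ (n ℕ.∸ 1) (j ℕ.∸ 1) (suc k) ℤ.- run w σ n (j ℕ.∸ 1) (suc (suc k)))
m₂Par w σ n j _ = ∞   -- k = 1 : λ^{j-1}_0 = ∞

kPar : (ℕ → ℕ → ℕ) → RunChoices → ℕ → ℕ → ℕ → ℤ
kPar w σ n j k = run w σ (n ℕ.∸ 1) j k ℤ.- run w σ (n ℕ.∸ 1) (j ℕ.∸ 1) k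

-- σ is a positive-probability realisation of the randomness for qRSK on an N×m input
Admissible : ℚ → (N m : ℕ) → (ℕ → ℕ → ℕ) → RunChoices → Set
Admissible q N m w σ = ∀ n j k → 1 ℕ.≤ n → n ℕ.≤ N → j ℕ.≤ m → 1 ℕ.≤ k → k ℕ.< j →
  SuppPos q (m₁Par w σ n j k) (m₂Par w σ n j k) (kPar w σ n j k) (σ n j k)

sumℤ : ℕ → (ℕ → ℤ) → ℤ
sumℤ zero    f = + 0
sumℤ (suc n) f = sumℤ n f ℤ.+ f (suc n)

sumℕ : ℕ → (ℕ → ℕ) → ℕ
sumℕ zero    f = 0
sumℕ (suc n) f = sumℕ n f ℕ.+ f (suc n)

{-# OPTIONS --safe #-}
module Submission where

-- (1) Whatever the samples a^j_{k+1} are, one insertion adds a_1 + … + a_k to the full row sum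
--     λ^k_1 + … + λ^k_k, since the update rule for λ̃^j_k telescopes in k.
--     Hence the full row sum of λ^k(n) is ∑_{i ≤ n} ∑_{j ≤ k} w_{i,j}.
-- (2) On every positive-probability realisation λ^j_i(n) = 0 for i > n. Inductively the sample
--     a^j_{i+1} with i > n then has parameter k = λ^j_i(n) − λ^{j−1}_i(n) = 0, and qHyp(·,·,0)
--     is the point mass at 0, so the row never grows beyond n parts.
--     Hence the full row sum equals the sum of its first min(k, n) entries.

open import Defs
open import Data.Nat using (ℕ; _≤_; _⊓_; zero; suc; _<_; z≤n; s≤s; _<?_; _≟_)
open import Data.Integer using (+_; ℤ; _+_; _-_)
open import Data.Rational using (ℚ; 0ℚ; 1ℚ) renaming (_≤_ to _≤ℚ_; _<_ to _<ℚ_)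
open import Data.Fin using (Fin)
open import Relation.Binary.PropositionalEquality
  using (_≡_; refl; sym; cong; cong₂; module ≡-Reasoning)
open import Data.Nat.Properties
  using (≤-refl; m<n⇒m<1+n; n<1+n; ≤-trans; ≤-total; ≤-pred; <⇒≤; <-irrefl; <-asym; <-cmp; m∸n≤m;
         n≤0⇒n≡0; m≤n⇒m<n∨m≡n; m≤n⇒m⊓n≡m; m≥n⇒m⊓n≡n)
open import Data.Integer.Properties using (+-identityʳ)
open import Data.Integer.Tactic.RingSolver using (solve-∀)
open import Data.Product using (_,_)
open import Data.Sum using (inj₁; inj₂)
open import Data.Empty using (⊥-elim)
open import Relation.Binary.Definitions using (tri<; tri≈; tri>)
open import Relation.Nullary using (yes; no)

open ≡-Reasoning

sumℤ-zero : ∀ k → sumℤ k (λ _ → + 0) ≡ + 0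
sumℤ-zero zero    = refl
sumℤ-zero (suc k) = cong (_+ + 0) (sumℤ-zero k)

sumℤ-+ : ∀ k (f : ℕ → ℕ) → sumℤ k (λ i → + f i) ≡ + sumℕ k f
sumℤ-+ zero    f = refl
sumℤ-+ (suc k) f = cong (_+ + f (suc k)) (sumℤ-+ k f)

sumℤ-vanishing-tail : ∀ (f : ℕ → ℤ) {n k} → n ≤ k → (∀ {i} → n < i → f i ≡ + 0) →
                      sumℤ k f ≡ sumℤ n f
sumℤ-vanishing-tail f {k = zero} z≤n _ = refl
sumℤ-vanishing-tail f {n} {suc k} n≤1+k f≡0 with m≤n⇒m<n∨m≡n n≤1+k
... | inj₂ refl  = refl
... | inj₁ n<1+k = begin
  sumℤ k f + f (suc k) ≡⟨ cong₂ _+_ (sumℤ-vanishing-tail f (≤-pred n<1+k) f≡0) (f≡0 n<1+k) ⟩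
  sumℤ n f + + 0       ≡⟨ +-identityʳ (sumℤ n f) ⟩
  sumℤ n f             ∎

sumℤ-⊓-vanishing : ∀ (f : ℕ → ℤ) n k → (∀ {i} → n < i → f i ≡ + 0) →
                   sumℤ (k ⊓ n) f ≡ sumℤ k f
sumℤ-⊓-vanishing f n k f≡0 with ≤-total k n
... | inj₁ k≤n = cong (λ l → sumℤ l f) (m≤n⇒m⊓n≡m k≤n)
... | inj₂ n≤k = begin
  sumℤ (k ⊓ n) f ≡⟨ cong (λ l → sumℤ l f) (m≥n⇒m⊓n≡n n≤k) ⟩
  sumℤ n f       ≡⟨ sym (sumℤ-vanishing-tail f n≤k f≡0) ⟩
  sumℤ k f       ∎

module _ (lam : Pat) (a : ℕ → ℤ) (smp : Choices) where

  private
    new : ℕ → ℕ → ℤ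
    new = insert lam a smp

    a′ : ℕ → ℕ → ℤ
    a′ = aVal a smp

  insert-< : ∀ {j k} → k < j →
             new (suc j) (suc k) ≡ a′ (suc j) (suc k) + lam (suc j) (suc k)
                                     + new j (suc k) - lam j (suc k) - a′ (suc j) (suc (suc k))
  insert-< {j} {k} k<j with suc k <? suc j | suc k ≟ suc j
  ... | yes _    | _ = refl
  ... | no k≮j   | _ = ⊥-elim (k≮j (s≤s k<j))

  insert-≡ : ∀ j → new (suc j) (suc j) ≡ lam (suc j) (suc j) + a′ (suc j) (suc j)
  insert-≡ j with suc j <? suc j | suc j ≟ suc j
  ... | yes j<j | _      = ⊥-elim (<-irrefl refl j<j)
  ... | no _    | yes _  = refl
  ... | no _    | no j≢j = ⊥-elim (j≢j refl)

  insert-> : ∀ {j k} → j < k → new (suc j) (suc k) ≡ + 0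
  insert-> {j} {k} j<k with suc k <? suc j | suc k ≟ suc j
  ... | yes k<j | _     = ⊥-elim (<-asym k<j (s≤s j<k))
  ... | no _    | yes e = ⊥-elim (<-irrefl (sym e) (s≤s j<k))
  ... | no _    | no _  = refl

  sumℤ-insert-prefix : ∀ {i j} → i ≤ j →
    sumℤ i (new (suc j)) ≡ sumℤ i (lam (suc j)) + a (suc j) + sumℤ i (new j) - sumℤ i (lam j)
                             - a′ (suc j) (suc i)
  sumℤ-insert-prefix {zero}  {j} _   = cancel (a (suc j))
    where
    cancel : ∀ x → + 0 ≡ + 0 + x + + 0 - + 0 - x
    cancel = solve-∀
  sumℤ-insert-prefix {suc i} {j} i<j = begin
    sumℤ i (new (suc j)) + new (suc j) (suc i)
      ≡⟨ cong₂ _+_ (sumℤ-insert-prefix (<⇒≤ i<j)) (insert-< i<j) ⟩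
    (sumℤ i (lam (suc j)) + a (suc j) + sumℤ i (new j) - sumℤ i (lam j) - a′ (suc j) (suc i))
      + (a′ (suc j) (suc i) + lam (suc j) (suc i) + new j (suc i) - lam j (suc i)
         - a′ (suc j) (suc (suc i)))
      ≡⟨ regroup (sumℤ i (lam (suc j))) (a (suc j)) (sumℤ i (new j)) (sumℤ i (lam j))
                 (a′ (suc j) (suc i)) (lam (suc j) (suc i)) (new j (suc i)) (lam j (suc i))
                 (a′ (suc j) (suc (suc i))) ⟩
    sumℤ (suc i) (lam (suc j)) + a (suc j) + sumℤ (suc i) (new j) - sumℤ (suc i) (lam j)
      - a′ (suc j) (suc (suc i)) ∎
    where
    regroup : ∀ L A N L′ b l n l′ c →
      (L + A + N - L′ - b) + (b + l + n - l′ - c) ≡ (L + l) + A + (N + n) - (L′ + l′) - c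
    regroup = solve-∀

  sumℤ-insert : ∀ j → sumℤ j (new j) ≡ sumℤ j (lam j) + sumℤ j a
  sumℤ-insert zero    = refl
  sumℤ-insert (suc j) = begin
    sumℤ j (new (suc j)) + new (suc j) (suc j)
      ≡⟨ cong₂ _+_ (sumℤ-insert-prefix {j} ≤-refl) (insert-≡ j) ⟩
    (sumℤ j (lam (suc j)) + a (suc j) + sumℤ j (new j) - sumℤ j (lam j) - a′ (suc j) (suc j))
      + (lam (suc j) (suc j) + a′ (suc j) (suc j))
      ≡⟨ cong (λ s → sumℤ j (lam (suc j)) + a (suc j) + s - sumℤ j (lam j) - a′ (suc j) (suc j)
                      + (lam (suc j) (suc j) + a′ (suc j) (suc j)))
              (sumℤ-insert j) ⟩
    (sumℤ j (lam (suc j)) + a (suc j) + (sumℤ j (lam j) + sumℤ j a) - sumℤ j (lam j)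
      - a′ (suc j) (suc j)) + (lam (suc j) (suc j) + a′ (suc j) (suc j))
      ≡⟨ regroup (sumℤ j (lam (suc j))) (a (suc j)) (sumℤ j (lam j)) (sumℤ j a)
                 (a′ (suc j) (suc j)) (lam (suc j) (suc j)) ⟩
    sumℤ (suc j) (lam (suc j)) + sumℤ (suc j) a ∎
    where
    regroup : ∀ L A L′ S b l → (L + A + (L′ + S) - L′ - b) + (l + b) ≡ (L + l) + (S + A)
    regroup = solve-∀

sumℤ-run : ∀ (w : ℕ → ℕ → ℕ) σ n k → sumℤ k (run w σ n k) ≡ + sumℕ n (λ i → sumℕ k (w i))
sumℤ-run w σ zero    k = sumℤ-zero k
sumℤ-run w σ (suc n) k = begin
  sumℤ k (run w σ (suc n) k)
    ≡⟨ sumℤ-insert (run w σ n) (λ j → + w (suc n) j) (σ (suc n)) k ⟩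
  sumℤ k (run w σ n k) + sumℤ k (λ j → + w (suc n) j)
    ≡⟨ cong₂ _+_ (sumℤ-run w σ n k) (sumℤ-+ k (w (suc n))) ⟩
  + sumℕ (suc n) (λ i → sumℕ k (w i)) ∎

SuppPos-k≡0⇒s≡0 : ∀ {q m₁ m₂ k s} → SuppPos q m₁ m₂ k s → k ≡ + 0 → s ≡ + 0
SuppPos-k≡0⇒s≡0 {m₂ = fin _} (_ , _ , _ , _ , _ , _ , refl , refl , (_ , s≤0 , _) , _) refl =
  cong +_ (n≤0⇒n≡0 s≤0)
SuppPos-k≡0⇒s≡0 {m₂ = ∞} (_ , _ , _ , _ , refl , refl , (_ , s≤0) , _) refl =
  cong +_ (n≤0⇒n≡0 s≤0)

PartsVanishBeyond : (ℕ → ℕ → ℕ) → RunChoices → (m n : ℕ) → Set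
PartsVanishBeyond w σ m n = ∀ {j i} → j ≤ m → n < i → run w σ n j i ≡ + 0

module _ {q N m} {w : ℕ → ℕ → ℕ} {σ : RunChoices} (adm : Admissible q N m w σ) where

  sample-vanishes : ∀ {n} → PartsVanishBeyond w σ m n → suc n ≤ N →
                    ∀ {j k} → j ≤ m → k < j → n < k → σ (suc n) j k ≡ + 0
  sample-vanishes {n} van 1+n≤N {j} {k} j≤m k<j n<k =
    SuppPos-k≡0⇒s≡0 (adm (suc n) j k (s≤s z≤n) 1+n≤N j≤m (≤-trans (s≤s z≤n) n<k) k<j)
                    (cong₂ _-_ (van j≤m n<k) (van (≤-trans (m∸n≤m j 1) j≤m) n<k))

  vanishing-step : ∀ {n} → PartsVanishBeyond w σ m n → suc n ≤ N → PartsVanishBeyond w σ m (suc n)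
  vanishing-step _ _ {zero}  _ _ = refl
  vanishing-step _ _ {suc _} {zero} _ ()
  vanishing-step _ _ {suc _} {suc zero} _ (s≤s ())
  vanishing-step {n} van 1+n≤N {suc j} {suc (suc i)} 1+j≤m (s≤s n<1+i) with <-cmp (suc i) j
  ... | tri< 1+i<j _ _
    rewrite insert-< (run w σ n) (λ j → + w (suc n) j) (σ (suc n)) 1+i<j
          | sample-vanishes van 1+n≤N 1+j≤m (s≤s (<⇒≤ 1+i<j)) n<1+i
          | sample-vanishes van 1+n≤N 1+j≤m (s≤s 1+i<j) (m<n⇒m<1+n n<1+i)
          | van 1+j≤m (m<n⇒m<1+n n<1+i)
          | van (<⇒≤ 1+j≤m) (m<n⇒m<1+n n<1+i)
          | vanishing-step van 1+n≤N (<⇒≤ 1+j≤m) (s≤s n<1+i)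
          = refl
  ... | tri≈ _ refl _
    rewrite insert-≡ (run w σ n) (λ j → + w (suc n) j) (σ (suc n)) (suc i)
          | van 1+j≤m (m<n⇒m<1+n n<1+i)
          | sample-vanishes van 1+n≤N 1+j≤m (n<1+n (suc i)) n<1+i
          = refl
  ... | tri> _ _ j<1+i = insert-> (run w σ n) (λ j → + w (suc n) j) (σ (suc n)) j<1+i

  parts-vanish-beyond : ∀ {n} → n ≤ N → PartsVanishBeyond w σ m n
  parts-vanish-beyond {zero}  _     _ _ = refl
  parts-vanish-beyond {suc n} 1+n≤N     = vanishing-step (parts-vanish-beyond (<⇒≤ 1+n≤N)) 1+n≤N

lemma2p7 : (q : ℚ) → 0ℚ ≤ℚ q → q <ℚ 1ℚ →
    (N m : ℕ) (w : Fin N → Fin m → ℕ) (σ : RunChoices) →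
    Admissible q N m (wExt w) σ →
    (n k : ℕ) → n ≤ N → 1 ≤ k → k ≤ m →
      sumℤ (k ⊓ n) (λ i → run (wExt w) σ n k i)
        ≡ + sumℕ n (λ i → sumℕ k (λ j → wExt w i j))
lemma2p7 _ _ _ N m w σ adm n k n≤N _ k≤m = begin
  sumℤ (k ⊓ n) (run (wExt w) σ n k)
    ≡⟨ sumℤ-⊓-vanishing (run (wExt w) σ n k) n k (parts-vanish-beyond adm n≤N k≤m) ⟩
  sumℤ k (run (wExt w) σ n k)
    ≡⟨ sumℤ-run (wExt w) σ n k ⟩
  + sumℕ n (λ i → sumℕ k (wExt w i)) ∎
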